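{- Let $\mathbf A\in\mathbb V(\mathbf{PP}_6^{\Rightarrow_H})$ and $D\subseteq A$. The matrix $\langle\mathbf A,D\rangle$ is a reduced model of $\mathcal{PP}^{\Rightarrow_H}_{\le}$ if and only if $D$ is a lattice filter of $\mathbf A$ that contains exactly one regular filter of $\mathbf A$ (namely $\{\top^{\mathbf A}\}$).
   Context: $\mathbf{PP}_6^{\Rightarrow_H}$ is the algebra in signature $\{\land,\lor,\Rightarrow,{\sim},\circ,\bot,\top\}$ with carrier $\mathcal V_6=\{\hat{\mathbf f},\mathbf f,\mathbf n,\mathbf b,\mathbf t,\hat{\mathbf t}\}$ ordered by $\hat{\mathbf f}<\mathbf f<\mathbf n<\mathbf t<\hat{\mathbf t}$, $\mathbf f<\mathbf b<\mathbf t$, $\mathbf n,\mathbf b$ incomparable; $\land,\lor$ meet and join, $\bot=\hat{\mathbf f}$, $\top=\hat{\mathbf t}$, ${\sim}$ swaps $\mathbf f\leftrightarrow\mathbf t$, $\hat{\mathbf f}\leftrightarrow\hat{\mathbf t}$ and fixes $\mathbf n,\mathbf b$; $\circ a=\hat{\mathbf t}$ if $a\in\{\hat{\mathbf f},\hat{\mathbf t}\}$, else $\hat{\mathbf f}$; $a\Rightarrow b=\max\{c: a\land c\le b\}$. $\mathbb V(\mathbf{PP}_6^{\Rightarrow_H})$ is the variety it generates. $\mathcal{PP}^{\Rightarrow_H}_{\le}$ is the Set-Fmla logic: $\Phi\vdash\psi$ iff for some finite $\Phi'\subseteq\Phi$ the inequality $\bigwedge\Phi'\le\psi$ ($\bigwedge\varnothing=\top$)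 holds in all members of $\mathbb V(\mathbf{PP}_6^{\Rightarrow_H})$ under all assignments. A matrix $\langle\mathbf A,D\rangle$ is a model of a Set-Fmla logic $\vdash$ if $\Phi\vdash\psi$ implies that every homomorphism $h$ from formulas to $\mathbf A$ with $h(\Phi)\subseteq D$ has $h(\psi)\in D$; it is reduced if its Leibniz congruence (the largest congruence $\theta$ of $\mathbf A$ such that $a\in D$ and $a\,\theta\,b$ imply $b\in D$) is the identity. Let $\neg x=x\Rightarrow{\sim}(x\Rightarrow x)$ and $\Delta x=\neg{\sim}x$. A filter of $\mathbf A$ is a non-empty lattice filter of its bounded lattice reduct; it is regular if $\Delta a\in F$ whenever $a\in F$. -}

module Defs where

open import Data.Nat using (ℕ)
open import Data.Bool using (Bool; true; false; if_then_else_)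
open import Data.List using (List; []; _∷_)
open import Data.List.Relation.Unary.All using (All)
open import Data.Product using (Σ; _×_; ∃)
open import Relation.Binary.PropositionalEquality using (_≡_)
open import Level using (Level; suc; 0ℓ)

-- Algebras in the signature {∧, ∨, ⇒, ~, ∘, ⊥, ⊤}
-- (carrier with propositional equality; no axioms are imposed here,
--  membership in the variety supplies them)

record Algebra : Set₁ where
  field
    Carrier : Set
    _∧ᴬ_ _∨ᴬ_ _⇒ᴬ_ : Carrier → Carrier → Carrier
    ~ᴬ ∘ᴬ : Carrier → Carrier
    ⊥ᴬ ⊤ᴬ : Carrier

data V6 : Set where
  ^f f n b t ^t : V6

-- the order ^f < f < n < t < ^t ,  f < b < t
_≤ᵇ_ : V6 → V6 → Bool
^f ≤ᵇ _  = true
f  ≤ᵇ ^f = false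
f  ≤ᵇ _  = true
n  ≤ᵇ n  = true
n  ≤ᵇ t  = true
n  ≤ᵇ ^t = true
n  ≤ᵇ _  = false
b  ≤ᵇ b  = true
b  ≤ᵇ t  = true
b  ≤ᵇ ^t = true
b  ≤ᵇ _  = false
t  ≤ᵇ t  = true
t  ≤ᵇ ^t = true
t  ≤ᵇ _  = false
^t ≤ᵇ ^t = true
^t ≤ᵇ _  = false

-- meet and join (the only incomparable pair is {n, b}, with meet f, join t)
meet6 : V6 → V6 → V6
meet6 x y = if x ≤ᵇ y then x else (if y ≤ᵇ x then y else f)

join6 : V6 → V6 → V6
join6 x y = if x ≤ᵇ y then y else (if y ≤ᵇ x then x else t)

-- a ⇒ c = max { d : a ∧ d ≤ c }  (relative pseudocomplement), by table
imp6 : V6 → V6 → V6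
imp6 a c = if a ≤ᵇ c then ^t else imp' a c
  where
  imp' : V6 → V6 → V6
  imp' _  ^f = ^f
  imp' n  f  = b
  imp' b  f  = n
  imp' _  f  = f
  imp' _  n  = n
  imp' _  b  = b
  imp' _  t  = t
  imp' _  ^t = ^t

neg6 : V6 → V6
neg6 ^f = ^t
neg6 f  = t
neg6 n  = n
neg6 b  = b
neg6 t  = f
neg6 ^t = ^f

circ6 : V6 → V6
circ6 ^f = ^t
circ6 ^t = ^t
circ6 _  = ^f

PP6 : Algebra
PP6 = record
  { Carrier = V6
  ; _∧ᴬ_ = meet6 ; _∨ᴬ_ = join6 ; _⇒ᴬ_ = imp6
  ; ~ᴬ = neg6 ; ∘ᴬ = circ6 ; ⊥ᴬ = ^f ; ⊤ᴬ = ^t }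

data Term : Set where
  var : ℕ → Term
  _∧ₜ_ _∨ₜ_ _⇒ₜ_ : Term → Term → Term
  ~ₜ ∘ₜ : Term → Term
  ⊥ₜ ⊤ₜ : Term

module _ (A : Algebra) where
  open Algebra A

  eval : (ℕ → Carrier) → Term → Carrier
  eval ρ (var i)   = ρ i
  eval ρ (s ∧ₜ u)  = eval ρ s ∧ᴬ eval ρ u
  eval ρ (s ∨ₜ u)  = eval ρ s ∨ᴬ eval ρ u
  eval ρ (s ⇒ₜ u)  = eval ρ s ⇒ᴬ eval ρ u
  eval ρ (~ₜ s)    = ~ᴬ (eval ρ s)
  eval ρ (∘ₜ s)    = ∘ᴬ (eval ρ s)
  eval ρ ⊥ₜ        = ⊥ᴬ
  eval ρ ⊤ₜ        = ⊤ᴬ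

  Holds : Term → Term → Set
  Holds s u = (ρ : ℕ → Carrier) → eval ρ s ≡ eval ρ u

  _≤ᴬ_ : Carrier → Carrier → Set
  x ≤ᴬ y = (x ∧ᴬ y) ≡ x

  ¬ᴬ : Carrier → Carrier
  ¬ᴬ x = x ⇒ᴬ ~ᴬ (x ⇒ᴬ x)

  Δᴬ : Carrier → Carrier
  Δᴬ x = ¬ᴬ (~ᴬ x)

  IsFilter : (Carrier → Set) → Set
  IsFilter F = (∃ λ a → F a)
             × (∀ x y → F x → x ≤ᴬ y → F y)
             × (∀ x y → F x → F y → F (x ∧ᴬ y))

  IsRegularFilter : (Carrier → Set) → Set
  IsRegularFilter F = IsFilter F × (∀ x → F x → F (Δᴬ x))

  IsCongruence : (Carrier → Carrier → Set) → Set
  IsCongruence θ =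
      (∀ x → θ x x)
    × (∀ x y → θ x y → θ y x)
    × (∀ x y z → θ x y → θ y z → θ x z)
    × (∀ x y x' y' → θ x x' → θ y y' → θ (x ∧ᴬ y) (x' ∧ᴬ y'))
    × (∀ x y x' y' → θ x x' → θ y y' → θ (x ∨ᴬ y) (x' ∨ᴬ y'))
    × (∀ x y x' y' → θ x x' → θ y y' → θ (x ⇒ᴬ y) (x' ⇒ᴬ y'))
    × (∀ x x' → θ x x' → θ (~ᴬ x) (~ᴬ x'))
    × (∀ x x' → θ x x' → θ (∘ᴬ x) (∘ᴬ x'))

  Compatible : (Carrier → Set) → (Carrier → Carrier → Set) → Set
  Compatible D θ = ∀ x y → D x → θ x y → D y

  -- the Leibniz congruence of ⟨A,D⟩ (the largest congruence compatible
  -- with D) is the identity: every congruence compatible with D is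
  -- contained in the identity relation
  IsReduced : (Carrier → Set) → Set₁
  IsReduced D = (θ : Carrier → Carrier → Set) → IsCongruence θ →
                Compatible D θ → ∀ x y → θ x y → x ≡ y

-- The variety generated by PP6: all algebras satisfying every identity
-- valid in PP6 (the smallest equationally defined class containing PP6)

InV : Algebra → Set
InV A = (s u : Term) → Holds PP6 s u → Holds A s u

⋀ : List Term → Term
⋀ []       = ⊤ₜ
⋀ (φ ∷ Φ)  = φ ∧ₜ ⋀ Φ

_⊢_ : (Term → Set) → Term → Set₁
Φ ⊢ ψ = Σ (List Term) λ Φ' → All Φ Φ' ×
          ((B : Algebra) → InV B → (ρ : ℕ → Algebra.Carrier B) →
             _≤ᴬ_ B (eval B ρ (⋀ Φ')) (eval B ρ ψ))

IsModel : (A : Algebra) → (Algebra.Carrier A → Set) → Set₁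
IsModel A D = (Φ : Term → Set) (ψ : Term) → Φ ⊢ ψ →
              (h : ℕ → Algebra.Carrier A) →
              (∀ φ → Φ φ → D (eval A h φ)) → D (eval A h ψ)

ExactlyOneRegularFilterIn : (A : Algebra) → (Algebra.Carrier A → Set) → Set₁
ExactlyOneRegularFilterIn A D =
  Σ (Algebra.Carrier A → Set) λ F →
    IsRegularFilter A F × (∀ x → F x → D x) ×
    (∀ x → F x → x ≡ Algebra.⊤ᴬ A) × (∀ x → x ≡ Algebra.⊤ᴬ A → F x) ×
    ((G : Algebra.Carrier A → Set) → IsRegularFilter A G → (∀ x → G x → D x) →
       ∀ x → (G x → F x) × (F x → G x))

-- Identities of PP6 are decided by running through all assignments of their
-- variables; they then hold in every A ∈ V and yield the needed lattice facts and
-- entailments.  The models of the logic are exactly the lattice filters.  The term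
-- a ⇔ c = Δ((a ⇒ c ∧ c ⇒ a) ∧ (~a ⇒ ~c ∧ ~c ⇒ ~a)) turns every filter G into a
-- congruence {(a , c) | a ⇔ c ∈ G}, compatible with D when G ⊆ D, and if G is
-- regular then a ∈ G gives a ⇔ ⊤ ∈ G.  Conversely the ⊤-class of a congruence
-- compatible with D is a regular filter inside D, and a congruence whose ⊤-class is
-- {⊤} is the identity.
{-# OPTIONS --safe #-}
module Submission where

open import Defs
open import Data.Empty using (⊥)
open import Data.List using (List; []; _∷_)
open import Data.List.Membership.Propositional using (_∈_)
open import Data.List.Relation.Unary.All as All using (All; []; _∷_; all?)
open import Data.List.Relation.Unary.Any using (here; there)
open import Data.Nat using (ℕ; zero; suc; _<_; _⊔_; s≤s)
open import Data.Nat.Properties using (eq?; ≤-refl; <-≤-trans; m≤m⊔n; m≤n⊔m)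
open import Data.Product using (_×_; _,_; proj₁)
open import Data.Sum using (_⊎_; inj₁; inj₂)
open import Data.Vec using (Vec; []; _∷_)
open import Function.Bundles using (mk↣)
open import Relation.Binary.Definitions using (DecidableEquality)
open import Relation.Binary.PropositionalEquality
open import Relation.Nullary.Decidable using (Dec; True; toWitness; map′)

V6-toℕ : V6 → ℕ
V6-toℕ ^f = 0
V6-toℕ f  = 1
V6-toℕ n  = 2
V6-toℕ b  = 3
V6-toℕ t  = 4
V6-toℕ ^t = 5

V6-fromℕ : ℕ → V6
V6-fromℕ 0 = ^f
V6-fromℕ 1 = f
V6-fromℕ 2 = n
V6-fromℕ 3 = b
V6-fromℕ 4 = t
V6-fromℕ _ = ^t

V6-fromℕ-toℕ : ∀ x → V6-fromℕ (V6-toℕ x) ≡ x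
V6-fromℕ-toℕ ^f = refl
V6-fromℕ-toℕ f  = refl
V6-fromℕ-toℕ n  = refl
V6-fromℕ-toℕ b  = refl
V6-fromℕ-toℕ t  = refl
V6-fromℕ-toℕ ^t = refl

_≟V6_ : DecidableEquality V6
_≟V6_ = eq? (mk↣ λ {x} {y} eq →
  trans (sym (V6-fromℕ-toℕ x)) (trans (cong V6-fromℕ eq) (V6-fromℕ-toℕ y)))

allV6 : List V6
allV6 = ^f ∷ f ∷ n ∷ b ∷ t ∷ ^t ∷ []

∈-allV6 : ∀ x → x ∈ allV6
∈-allV6 ^f = here refl
∈-allV6 f  = there (here refl)
∈-allV6 n  = there (there (here refl))
∈-allV6 b  = there (there (there (here refl)))
∈-allV6 t  = there (there (there (there (here refl))))
∈-allV6 ^t = there (there (there (there (there (here refl)))))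

∀-V6? : {P : V6 → Set} → (∀ x → Dec (P x)) → Dec (∀ x → P x)
∀-V6? P? = map′ (λ all x → All.lookup all (∈-allV6 x)) (λ p → All.tabulate (λ {x} _ → p x))
                (all? P? allV6)

∀-Vec? : ∀ k {P : Vec V6 k → Set} → (∀ v → Dec (P v)) → Dec (∀ v → P v)
∀-Vec? zero    P? = map′ (λ { p [] → p }) (λ p → p []) (P? [])
∀-Vec? (suc k) P? = map′ (λ { p (x ∷ v) → p x v }) (λ p x v → p (x ∷ v))
                         (∀-V6? λ x → ∀-Vec? k λ v → P? (x ∷ v))

assign : {X : Set} {k : ℕ} → X → Vec X k → ℕ → X
assign d []      _       = d
assign d (x ∷ v) zero    = x
assign d (x ∷ v) (suc i) = assign d v i

prefix : {X : Set} (k : ℕ) → (ℕ → X) → Vec X k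
prefix zero    ρ = []
prefix (suc k) ρ = ρ 0 ∷ prefix k (λ i → ρ (suc i))

assign-prefix : {X : Set} {d : X} (k : ℕ) (ρ : ℕ → X) → ∀ i → i < k → assign d (prefix k ρ) i ≡ ρ i
assign-prefix (suc k) ρ zero    _         = refl
assign-prefix (suc k) ρ (suc i) (s≤s i<k) = assign-prefix k (λ j → ρ (suc j)) i i<k

varBound : Term → ℕ
varBound (var i)  = suc i
varBound (s ∧ₜ u) = varBound s ⊔ varBound u
varBound (s ∨ₜ u) = varBound s ⊔ varBound u
varBound (s ⇒ₜ u) = varBound s ⊔ varBound u
varBound (~ₜ s)   = varBound s
varBound (∘ₜ s)   = varBound s
varBound ⊥ₜ       = 0
varBound ⊤ₜ       = 0

AgreeBelow : {X : Set} → ℕ → (ℕ → X) → (ℕ → X) → Set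
AgreeBelow k ρ σ = ∀ i → i < k → ρ i ≡ σ i

agreeˡ : {X : Set} (s u : Term) {ρ σ : ℕ → X} →
         AgreeBelow (varBound s ⊔ varBound u) ρ σ → AgreeBelow (varBound s) ρ σ
agreeˡ s u agree i i<s = agree i (<-≤-trans i<s (m≤m⊔n (varBound s) (varBound u)))

agreeʳ : {X : Set} (s u : Term) {ρ σ : ℕ → X} →
         AgreeBelow (varBound s ⊔ varBound u) ρ σ → AgreeBelow (varBound u) ρ σ
agreeʳ s u agree i i<u = agree i (<-≤-trans i<u (m≤n⊔m (varBound s) (varBound u)))

eval-local : (A : Algebra) (ρ σ : ℕ → Algebra.Carrier A) (s : Term) →
             AgreeBelow (varBound s) ρ σ → eval A ρ s ≡ eval A σ s
eval-local A ρ σ (var i)  agree = agree i ≤-refl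
eval-local A ρ σ (s ∧ₜ u) agree =
  cong₂ (Algebra._∧ᴬ_ A) (eval-local A ρ σ s (agreeˡ s u agree)) (eval-local A ρ σ u (agreeʳ s u agree))
eval-local A ρ σ (s ∨ₜ u) agree =
  cong₂ (Algebra._∨ᴬ_ A) (eval-local A ρ σ s (agreeˡ s u agree)) (eval-local A ρ σ u (agreeʳ s u agree))
eval-local A ρ σ (s ⇒ₜ u) agree =
  cong₂ (Algebra._⇒ᴬ_ A) (eval-local A ρ σ s (agreeˡ s u agree)) (eval-local A ρ σ u (agreeʳ s u agree))
eval-local A ρ σ (~ₜ s)   agree = cong (Algebra.~ᴬ A) (eval-local A ρ σ s agree)
eval-local A ρ σ (∘ₜ s)   agree = cong (Algebra.∘ᴬ A) (eval-local A ρ σ s agree)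
eval-local A ρ σ ⊥ₜ       agree = refl
eval-local A ρ σ ⊤ₜ       agree = refl

-- Only the first varBound s ⊔ varBound u variables matter, so checking all their
-- assignments decides the identity.
holds? : ∀ s u → Dec (Holds PP6 s u)
holds? s u = map′ fromAssignments (λ h v → h (assign ^f v))
                  (∀-Vec? k λ v → eval PP6 (assign ^f v) s ≟V6 eval PP6 (assign ^f v) u)
  where
  k : ℕ
  k = varBound s ⊔ varBound u

  fromAssignments : (∀ v → eval PP6 (assign ^f v) s ≡ eval PP6 (assign ^f v) u) → Holds PP6 s u
  fromAssignments h ρ = begin
    eval PP6 ρ s   ≡⟨ eval-local PP6 ρ ρ' s (agreeˡ s u agree) ⟩
    eval PP6 ρ' s  ≡⟨ h (prefix k ρ) ⟩
    eval PP6 ρ' u  ≡⟨ sym (eval-local PP6 ρ ρ' u (agreeʳ s u agree)) ⟩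
    eval PP6 ρ u   ∎
    where
    open ≡-Reasoning
    ρ' : ℕ → V6
    ρ' = assign ^f (prefix k ρ)
    agree : AgreeBelow k ρ ρ'
    agree i i<k = sym (assign-prefix k ρ i i<k)

⊢-byPP6 : {Φ : Term → Set} (Φ' : List Term) (ψ : Term) → All Φ Φ' →
            {valid : True (holds? (⋀ Φ' ∧ₜ ψ) (⋀ Φ'))} → Φ ⊢ ψ
⊢-byPP6 Φ' ψ Φ⊇Φ' {valid} = Φ' , Φ⊇Φ' , λ B B∈V → B∈V (⋀ Φ' ∧ₜ ψ) (⋀ Φ') (toWitness valid)

x₀ x₁ x₂ x₃ : Term
x₀ = var 0
x₁ = var 1
x₂ = var 2
x₃ = var 3

Δₜ : Term → Term
Δₜ s = ~ₜ s ⇒ₜ ~ₜ (~ₜ s ⇒ₜ ~ₜ s)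

_⇔ₜ_ : Term → Term → Term
s ⇔ₜ u = Δₜ (((s ⇒ₜ u) ∧ₜ (u ⇒ₜ s)) ∧ₜ ((~ₜ s ⇒ₜ ~ₜ u) ∧ₜ (~ₜ u ⇒ₜ ~ₜ s)))

module _ (A : Algebra) where
  open Algebra A renaming (_∧ᴬ_ to infixr 8 _∧_; _∨ᴬ_ to infixr 7 _∨_; _⇒ᴬ_ to infixr 6 _⇒_; ~ᴬ to ~)

  infix 4 _≤_
  _≤_ : Carrier → Carrier → Set
  _≤_ = _≤ᴬ_ A

  Δ : Carrier → Carrier
  Δ = Δᴬ A

  -- In PP6, a ⇔ c is ⊤ when a = c and ⊥ otherwise.
  infix 5 _⇔_
  _⇔_ : Carrier → Carrier → Carrier
  a ⇔ c = Δ (((a ⇒ c) ∧ (c ⇒ a)) ∧ ((~ a ⇒ ~ c) ∧ (~ c ⇒ ~ a)))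

  congruence-Δ : ∀ {θ : Carrier → Carrier → Set} → IsCongruence A θ → ∀ {a c} → θ a c → θ (Δ a) (Δ c)
  congruence-Δ (_ , _ , _ , _ , _ , θ-⇒ , θ-~ , _) θac =
    θ-⇒ _ _ _ _ (θ-~ _ _ θac) (θ-~ _ _ (θ-⇒ _ _ _ _ (θ-~ _ _ θac) (θ-~ _ _ θac)))

  model⇒filter : ∀ {D : Carrier → Set} → IsModel A D → IsFilter A D
  model⇒filter {D} D-model = (⊤ᴬ , D⊤) , upward , ∧-closed
    where
    D⊤ : D ⊤ᴬ
    D⊤ = D-model (λ _ → ⊥) ⊤ₜ (⊢-byPP6 [] ⊤ₜ []) (assign ⊤ᴬ []) (λ _ ())
    upward : ∀ x y → D x → x ≤ y → D y
    upward x y Dx x≤y =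
      D-model (_≡ x₀ ∧ₜ x₁) x₁ (⊢-byPP6 (x₀ ∧ₜ x₁ ∷ []) x₁ (refl ∷ [])) (assign ⊤ᴬ (x ∷ y ∷ []))
              (λ { _ refl → subst D (sym x≤y) Dx })
    ∧-closed : ∀ x y → D x → D y → D (x ∧ y)
    ∧-closed x y Dx Dy =
      D-model (λ φ → φ ≡ x₀ ⊎ φ ≡ x₁) (x₀ ∧ₜ x₁) (⊢-byPP6 (x₀ ∷ x₁ ∷ []) (x₀ ∧ₜ x₁) (inj₁ refl ∷ inj₂ refl ∷ []))
              (assign ⊤ᴬ (x ∷ y ∷ [])) (λ { _ (inj₁ refl) → Dx ; _ (inj₂ refl) → Dy })

  exactlyOneRegularFilterIn⇒⊆⊤ : ∀ {D : Carrier → Set} → ExactlyOneRegularFilterIn A D →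
    (G : Carrier → Set) → IsRegularFilter A G → (∀ x → G x → D x) → ∀ x → G x → x ≡ ⊤ᴬ
  exactlyOneRegularFilterIn⇒⊆⊤ (F , _ , _ , F⊆⊤ , _ , unique) G G-regular G⊆D x Gx =
    F⊆⊤ x (proj₁ (unique G G-regular G⊆D x) Gx)

  module _ (A∈V : InV A) where

    -- valid is inferred as tt exactly when holds? s u evaluates to yes, so each
    -- identity below is checked by computation.
    byPP6 : ∀ {k} s u {valid : True (holds? s u)} (v : Vec Carrier k) →
               eval A (assign ⊤ᴬ v) s ≡ eval A (assign ⊤ᴬ v) u
    byPP6 s u {valid} v = A∈V s u (toWitness valid) (assign ⊤ᴬ v)

    ∧-identityˡ : ∀ a → ⊤ᴬ ∧ a ≡ a
    ∧-identityˡ a = byPP6 (⊤ₜ ∧ₜ x₀) x₀ (a ∷ [])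

    ∧-identityʳ : ∀ a → a ∧ ⊤ᴬ ≡ a
    ∧-identityʳ a = byPP6 (x₀ ∧ₜ ⊤ₜ) x₀ (a ∷ [])

    ∧-comm : ∀ a c → a ∧ c ≡ c ∧ a
    ∧-comm a c = byPP6 (x₀ ∧ₜ x₁) (x₁ ∧ₜ x₀) (a ∷ c ∷ [])

    ∨-zeroˡ : ∀ a → ⊤ᴬ ∨ a ≡ ⊤ᴬ
    ∨-zeroˡ a = byPP6 (⊤ₜ ∨ₜ x₀) ⊤ₜ (a ∷ [])

    ∧-absorbed-by-∨ : ∀ a c → (a ∧ c) ∨ c ≡ c
    ∧-absorbed-by-∨ a c = byPP6 ((x₀ ∧ₜ x₁) ∨ₜ x₁) x₁ (a ∷ c ∷ [])

    ⇒-refl : ∀ a → a ⇒ a ≡ ⊤ᴬ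
    ⇒-refl a = byPP6 (x₀ ⇒ₜ x₀) ⊤ₜ (a ∷ [])

    ∧-⇒ : ∀ a c → a ∧ (a ⇒ c) ≡ a ∧ c
    ∧-⇒ a c = byPP6 (x₀ ∧ₜ (x₀ ⇒ₜ x₁)) (x₀ ∧ₜ x₁) (a ∷ c ∷ [])

    Δ-⊤ : Δ ⊤ᴬ ≡ ⊤ᴬ
    Δ-⊤ = byPP6 (Δₜ ⊤ₜ) ⊤ₜ []

    Δ-≤-⇔⊤ : ∀ a → Δ a ≤ a ⇔ ⊤ᴬ
    Δ-≤-⇔⊤ a = byPP6 (Δₜ x₀ ∧ₜ (x₀ ⇔ₜ ⊤ₜ)) (Δₜ x₀) (a ∷ [])

    ⇔-refl : ∀ a → a ⇔ a ≡ ⊤ᴬ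
    ⇔-refl a = byPP6 (x₀ ⇔ₜ x₀) ⊤ₜ (a ∷ [])

    ⇔-sym : ∀ a c → a ⇔ c ≡ c ⇔ a
    ⇔-sym a c = byPP6 (x₀ ⇔ₜ x₁) (x₁ ⇔ₜ x₀) (a ∷ c ∷ [])

    ⇔-trans : ∀ a m c → (a ⇔ m) ∧ (m ⇔ c) ≤ a ⇔ c
    ⇔-trans a m c =
      byPP6 (((x₀ ⇔ₜ x₁) ∧ₜ (x₁ ⇔ₜ x₂)) ∧ₜ (x₀ ⇔ₜ x₂)) ((x₀ ⇔ₜ x₁) ∧ₜ (x₁ ⇔ₜ x₂)) (a ∷ m ∷ c ∷ [])

    ∧-⇔-≤ : ∀ a c → a ∧ (a ⇔ c) ≤ c
    ∧-⇔-≤ a c = byPP6 ((x₀ ∧ₜ (x₀ ⇔ₜ x₁)) ∧ₜ x₁) (x₀ ∧ₜ (x₀ ⇔ₜ x₁)) (a ∷ c ∷ [])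

    ⇔-∧-mono : ∀ a a' c c' → (a ⇔ a') ∧ (c ⇔ c') ≤ (a ∧ c) ⇔ (a' ∧ c')
    ⇔-∧-mono a a' c c' =
      byPP6 (((x₀ ⇔ₜ x₁) ∧ₜ (x₂ ⇔ₜ x₃)) ∧ₜ ((x₀ ∧ₜ x₂) ⇔ₜ (x₁ ∧ₜ x₃))) ((x₀ ⇔ₜ x₁) ∧ₜ (x₂ ⇔ₜ x₃))
               (a ∷ a' ∷ c ∷ c' ∷ [])

    ⇔-∨-mono : ∀ a a' c c' → (a ⇔ a') ∧ (c ⇔ c') ≤ (a ∨ c) ⇔ (a' ∨ c')
    ⇔-∨-mono a a' c c' =
      byPP6 (((x₀ ⇔ₜ x₁) ∧ₜ (x₂ ⇔ₜ x₃)) ∧ₜ ((x₀ ∨ₜ x₂) ⇔ₜ (x₁ ∨ₜ x₃))) ((x₀ ⇔ₜ x₁) ∧ₜ (x₂ ⇔ₜ x₃))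
               (a ∷ a' ∷ c ∷ c' ∷ [])

    ⇔-⇒-mono : ∀ a a' c c' → (a ⇔ a') ∧ (c ⇔ c') ≤ (a ⇒ c) ⇔ (a' ⇒ c')
    ⇔-⇒-mono a a' c c' =
      byPP6 (((x₀ ⇔ₜ x₁) ∧ₜ (x₂ ⇔ₜ x₃)) ∧ₜ ((x₀ ⇒ₜ x₂) ⇔ₜ (x₁ ⇒ₜ x₃))) ((x₀ ⇔ₜ x₁) ∧ₜ (x₂ ⇔ₜ x₃))
               (a ∷ a' ∷ c ∷ c' ∷ [])

    ⇔-~-mono : ∀ a a' → a ⇔ a' ≤ ~ a ⇔ ~ a'
    ⇔-~-mono a a' = byPP6 ((x₀ ⇔ₜ x₁) ∧ₜ (~ₜ x₀ ⇔ₜ ~ₜ x₁)) (x₀ ⇔ₜ x₁) (a ∷ a' ∷ [])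

    ⇔-∘-mono : ∀ a a' → a ⇔ a' ≤ ∘ᴬ a ⇔ ∘ᴬ a'
    ⇔-∘-mono a a' = byPP6 ((x₀ ⇔ₜ x₁) ∧ₜ (∘ₜ x₀ ⇔ₜ ∘ₜ x₁)) (x₀ ⇔ₜ x₁) (a ∷ a' ∷ [])

    ≤-antisym : ∀ {a c} → a ≤ c → c ≤ a → a ≡ c
    ≤-antisym {a} {c} a≤c c≤a = trans (sym a≤c) (trans (∧-comm a c) c≤a)

    ≤⇒∨≡ : ∀ {a c} → a ≤ c → a ∨ c ≡ c
    ≤⇒∨≡ {a} {c} a≤c = trans (cong (_∨ c) (sym a≤c)) (∧-absorbed-by-∨ a c)

    ⇒≡⊤⇒≤ : ∀ {a c} → a ⇒ c ≡ ⊤ᴬ → a ≤ c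
    ⇒≡⊤⇒≤ {a} {c} a⇒c≡⊤ = begin
      a ∧ c        ≡⟨ sym (∧-⇒ a c) ⟩
      a ∧ (a ⇒ c)  ≡⟨ cong (a ∧_) a⇒c≡⊤ ⟩
      a ∧ ⊤ᴬ       ≡⟨ ∧-identityʳ a ⟩
      a            ∎
      where open ≡-Reasoning

    filter-⊤ : ∀ {F : Carrier → Set} → IsFilter A F → F ⊤ᴬ
    filter-⊤ ((a , Fa) , upward , _) = upward a ⊤ᴬ Fa (∧-identityʳ a)

    ⊤-isRegularFilter : IsRegularFilter A (_≡ ⊤ᴬ)
    ⊤-isRegularFilter = ((⊤ᴬ , refl) , upward , ∧-closed) , λ { _ refl → Δ-⊤ }
      where
      upward : ∀ x y → x ≡ ⊤ᴬ → x ≤ y → y ≡ ⊤ᴬ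
      upward _ y refl ⊤≤y = trans (sym (∧-identityˡ y)) ⊤≤y
      ∧-closed : ∀ x y → x ≡ ⊤ᴬ → y ≡ ⊤ᴬ → x ∧ y ≡ ⊤ᴬ
      ∧-closed _ _ refl refl = ∧-identityʳ ⊤ᴬ

    ⊤-class-isRegularFilter : ∀ {θ : Carrier → Carrier → Set} → IsCongruence A θ →
                              IsRegularFilter A (λ a → θ a ⊤ᴬ)
    ⊤-class-isRegularFilter {θ} θ-cong@(θ-refl , _ , _ , θ-∧ , θ-∨ , _) =
      ((⊤ᴬ , θ-refl ⊤ᴬ) , upward , ∧-closed) , regular
      where
      upward : ∀ x y → θ x ⊤ᴬ → x ≤ y → θ y ⊤ᴬ
      upward x y θx⊤ x≤y = subst₂ θ (≤⇒∨≡ x≤y) (∨-zeroˡ y) (θ-∨ x y ⊤ᴬ y θx⊤ (θ-refl y))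
      ∧-closed : ∀ x y → θ x ⊤ᴬ → θ y ⊤ᴬ → θ (x ∧ y) ⊤ᴬ
      ∧-closed x y θx⊤ θy⊤ = subst (θ (x ∧ y)) (∧-identityʳ ⊤ᴬ) (θ-∧ x y ⊤ᴬ ⊤ᴬ θx⊤ θy⊤)
      regular : ∀ x → θ x ⊤ᴬ → θ (Δ x) ⊤ᴬ
      regular x θx⊤ = subst (θ (Δ x)) Δ-⊤ (congruence-Δ θ-cong θx⊤)

    -- θ x y gives θ (x ⇒ y) ⊤, and x ⇒ y = ⊤ = y ⇒ x forces x = y.
    trivial-⊤-class⇒⊆≡ : ∀ {θ : Carrier → Carrier → Set} → IsCongruence A θ →
                         (∀ a → θ a ⊤ᴬ → a ≡ ⊤ᴬ) → ∀ x y → θ x y → x ≡ y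
    trivial-⊤-class⇒⊆≡ {θ} (θ-refl , θ-sym , _ , _ , _ , θ-⇒ , _) ⊤-class-trivial x y θxy =
      ≤-antisym (⇒≡⊤⇒≤ (⇒≡⊤ θxy)) (⇒≡⊤⇒≤ (⇒≡⊤ (θ-sym x y θxy)))
      where
      ⇒≡⊤ : ∀ {a c} → θ a c → a ⇒ c ≡ ⊤ᴬ
      ⇒≡⊤ {a} {c} θac = ⊤-class-trivial _ (subst (θ (a ⇒ c)) (⇒-refl c) (θ-⇒ a c c c θac (θ-refl c)))

    ⇔-isCongruence : ∀ {G : Carrier → Set} → IsFilter A G → IsCongruence A (λ a c → G (a ⇔ c))
    ⇔-isCongruence {G} G-filter@(_ , upward , ∧-closed) =
        (λ a → subst G (sym (⇔-refl a)) (filter-⊤ G-filter))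
      , (λ a c → subst G (⇔-sym a c))
      , (λ a m c Gam Gmc → upward _ _ (∧-closed _ _ Gam Gmc) (⇔-trans a m c))
      , preserves₂ ⇔-∧-mono
      , preserves₂ ⇔-∨-mono
      , preserves₂ ⇔-⇒-mono
      , (λ a a' Gaa' → upward _ _ Gaa' (⇔-~-mono a a'))
      , (λ a a' Gaa' → upward _ _ Gaa' (⇔-∘-mono a a'))
      where
      preserves₂ : {_∙_ : Carrier → Carrier → Carrier} →
                   (∀ a a' c c' → (a ⇔ a') ∧ (c ⇔ c') ≤ (a ∙ c) ⇔ (a' ∙ c')) →
                   ∀ a c a' c' → G (a ⇔ a') → G (c ⇔ c') → G ((a ∙ c) ⇔ (a' ∙ c'))
      preserves₂ mono a c a' c' Gaa' Gcc' = upward _ _ (∧-closed _ _ Gaa' Gcc') (mono a a' c c')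

    ⇔-compatible : ∀ {D G : Carrier → Set} → IsFilter A D → (∀ x → G x → D x) →
                 Compatible A D (λ a c → G (a ⇔ c))
    ⇔-compatible (_ , upward , ∧-closed) G⊆D x y Dx Gxy = upward _ y (∧-closed x _ Dx (G⊆D _ Gxy)) (∧-⇔-≤ x y)

    regular-⇔⊤ : ∀ {G : Carrier → Set} → IsRegularFilter A G → ∀ a → G a → G (a ⇔ ⊤ᴬ)
    regular-⇔⊤ ((_ , upward , _) , regular) a Ga = upward _ _ (regular a Ga) (Δ-≤-⇔⊤ a)

    filter⇒model : ∀ {D : Carrier → Set} → IsFilter A D → IsModel A D
    filter⇒model {D} D-filter@(_ , upward , ∧-closed) Φ ψ (Φ' , Φ⊇Φ' , Φ'≤ψ) h h[Φ]⊆D =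
      upward _ _ (⋀-closed Φ' Φ⊇Φ') (Φ'≤ψ A A∈V h)
      where
      ⋀-closed : ∀ Ψ → All Φ Ψ → D (eval A h (⋀ Ψ))
      ⋀-closed []      []         = filter-⊤ D-filter
      ⋀-closed (φ ∷ Ψ) (Φφ ∷ ΦΨ) = ∧-closed _ _ (h[Φ]⊆D φ Φφ) (⋀-closed Ψ ΦΨ)

    exactlyOneRegularFilterIn : ∀ {D : Carrier → Set} → D ⊤ᴬ →
      ((G : Carrier → Set) → IsRegularFilter A G → (∀ x → G x → D x) → ∀ x → G x → x ≡ ⊤ᴬ) →
      ExactlyOneRegularFilterIn A D
    exactlyOneRegularFilterIn {D} D⊤ only-⊤ =
        (_≡ ⊤ᴬ) , ⊤-isRegularFilter , (λ { _ refl → D⊤ }) , (λ _ x≡⊤ → x≡⊤) , (λ _ x≡⊤ → x≡⊤)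
      , λ G G-regular G⊆D x → only-⊤ G G-regular G⊆D x , λ { refl → filter-⊤ (proj₁ G-regular) }

proposition7p13 : (A : Algebra) → InV A → (D : Algebra.Carrier A → Set) →
                    ((IsModel A D × IsReduced A D) → (IsFilter A D × ExactlyOneRegularFilterIn A D))
                    × ((IsFilter A D × ExactlyOneRegularFilterIn A D) → (IsModel A D × IsReduced A D))
proposition7p13 A A∈V D = model-reduced⇒filter , filter⇒model-reduced
  where
  open Algebra A using (⊤ᴬ)

  model-reduced⇒filter : IsModel A D × IsReduced A D → IsFilter A D × ExactlyOneRegularFilterIn A D
  model-reduced⇒filter (D-model , D-reduced) =
    D-filter , exactlyOneRegularFilterIn A A∈V (filter-⊤ A A∈V D-filter) λ G G-regular G⊆D x Gx →
      D-reduced _ (⇔-isCongruence A A∈V (proj₁ G-regular)) (⇔-compatible A A∈V D-filter G⊆D)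
                x ⊤ᴬ (regular-⇔⊤ A A∈V G-regular x Gx)
    where
    D-filter : IsFilter A D
    D-filter = model⇒filter A D-model

  filter⇒model-reduced : IsFilter A D × ExactlyOneRegularFilterIn A D → IsModel A D × IsReduced A D
  filter⇒model-reduced (D-filter , exactlyOne) = filter⇒model A A∈V D-filter , D-reduced
    where
    D-reduced : IsReduced A D
    D-reduced θ θ-cong@(_ , θ-sym , _) θ-compatible =
      trivial-⊤-class⇒⊆≡ A A∈V θ-cong
        (exactlyOneRegularFilterIn⇒⊆⊤ A exactlyOne _ (⊤-class-isRegularFilter A A∈V θ-cong)
          λ x θx⊤ → θ-compatible ⊤ᴬ x (filter-⊤ A A∈V D-filter) (θ-sym x ⊤ᴬ θx⊤))
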